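{- Let $D=(F,T)\in\mathcal D_k$ and let $h:D\to H$ be a homomorphism from $D$ to some graph $H$. Then there exist a graph $G\sqsubseteq_{\mathrm{col}} D$, a shrinking epimorphism $f:D\twoheadrightarrow G$, and a past-injective homomorphism $g:(G,T[V(G)])\to H$ such that $h=g\circ f$. Furthermore, $G,f,g$ are unique: if $G'\sqsubseteq_{\mathrm{col}} D$, $f':D\twoheadrightarrow G'$ is a shrinking epimorphism and $g':(G',T[V(G')])\to H$ is a past-injective homomorphism with $h=g'\circ f'$, then $G=G'$, $f=f'$ and $g=g'$.
   Context: Graphs are finite, undirected, vertex-coloured triples $(V(G),E(G),\gamma^G)$. A homomorphism preserves edges and colours; an epimorphism $h:F\to G$ is a surjective homomorphism such that every edge of $G$ is the image of an edge of $F$. A tree is a finite set with partial order $\preceq$ with a unique minimal element such that each $\{u:u\preceq t\}$ is a chain; height = maximum size of a chain. For $U\subseteq V(T)$ with a unique minimal element, $T[U]$ is the tree on $U$ with the restricted order. An elimination tree of a graph $F$ is a tree on $V(F)$ with $u\preceq v$ or $v\preceq u$ for every edge $uv$. $\mathcal D_k$ is the class of pairs $D=(F,T)$ with $F$ a graph and $T$ an elimination tree of $F$ of height at most $k$; $V(D)=V(F)$, $\preceq^D=\preceq^T$, $\prec^D$ the strict order, and homomorphisms from $D$ are homomorphisms from $F$. A homomorphism $g:D\to H$ is past-injective if $g(u)\ne g(v)$ whenever $u\prec^D v$. $G\sqsubseteq_{\mathrm{col}} D$ means $V(G)\subseteq V(F)$ and $\gamma^G(v)=\gamma^F(v)$ for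 $v\in V(G)$. A shrinking epimorphism from $D$ to a graph $G$ with $V(G)\subseteq V(D)$ is an epimorphism $f:F\to G$ with $f(u)\preceq^D u$ and $f(f(u))=f(u)$ for all $u\in V(D)$. (For such $f$, $T[V(G)]$ is a tree and an elimination tree of $G$, so $(G,T[V(G)])\in\mathcal D_k$.) -}

module Defs where

open import Data.Nat using (ℕ; _≤_)
open import Data.Fin using (Fin)
open import Data.List using (List; length)
open import Data.List.Relation.Unary.AllPairs using (AllPairs)
open import Data.Product using (Σ; ∃; _×_; _,_)
open import Data.Sum using (_⊎_)
open import Relation.Nullary using (¬_; Dec)
open import Relation.Binary.PropositionalEquality using (_≡_; _≢_)
open import Relation.Binary.Structures using (IsPartialOrder)
open import Function.Bundles using (_⇔_)

record Graph (C : Set) : Set₁ where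
  field
    size   : ℕ
    E      : Fin size → Fin size → Set
    E?     : ∀ u v → Dec (E u v)
    col    : Fin size → C
    E-sym  : ∀ {u v} → E u v → E v u
    E-irr  : ∀ {u} → ¬ E u u
open Graph public

IsHom : ∀ {C} (F H : Graph C) → (Fin (size F) → Fin (size H)) → Set
IsHom F H h =
  (∀ u v → E F u v → E H (h u) (h v)) × (∀ u → col H (h u) ≡ col F u)

record Tree (n : ℕ) : Set₁ where
  field
    _⪯_        : Fin n → Fin n → Set
    _⪯?_       : ∀ u v → Dec (u ⪯ v)
    isPO       : IsPartialOrder _≡_ _⪯_
    root       : Fin n
    root-min   : ∀ v → v ⪯ root → v ≡ root
    root-uniq  : ∀ m → (∀ v → v ⪯ m → v ≡ m) → m ≡ root
    down-chain : ∀ t u v → u ⪯ t → v ⪯ t → u ⪯ v ⊎ v ⪯ u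
open Tree public

_≺⟨_⟩_ : ∀ {n} → Fin n → Tree n → Fin n → Set
u ≺⟨ T ⟩ v = _⪯_ T u v × u ≢ v

IsChain : ∀ {n} → Tree n → List (Fin n) → Set
IsChain T xs = AllPairs _≢_ xs × AllPairs (λ u v → _⪯_ T u v ⊎ _⪯_ T v u) xs

HeightAtMost : ∀ {n} → Tree n → ℕ → Set
HeightAtMost T k = ∀ xs → IsChain T xs → length xs ≤ k

IsEliminationTree : ∀ {C} (F : Graph C) → Tree (size F) → Set
IsEliminationTree F T = ∀ u v → E F u v → _⪯_ T u v ⊎ _⪯_ T v u

record Dk (C : Set) (k : ℕ) : Set₁ where
  field
    F      : Graph C
    T      : Tree (size F)
    elim   : IsEliminationTree F T
    height : HeightAtMost T k
open Dk public

-- A graph G with G ⊑col D: its vertex set is a (decidable) subset of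
-- V(F) = Fin (size F), and its colouring is the restriction of the colouring
-- of F (so it is not stored separately: γ^G(v) = col F v for v ∈ V(G)).

record ColSub {C} (F : Graph C) : Set₁ where
  field
    V      : Fin (size F) → Set
    V?     : ∀ v → Dec (V v)
    EG     : Fin (size F) → Fin (size F) → Set
    EG?    : ∀ u v → Dec (EG u v)
    EG-V   : ∀ {u v} → EG u v → V u × V v
    EG-sym : ∀ {u v} → EG u v → EG v u
    EG-irr : ∀ {u} → ¬ EG u u
open ColSub public

record IsShrinkingEpi {C k} (D : Dk C k) (G : ColSub (F D))
         (f : Fin (size (F D)) → Fin (size (F D))) : Set where
  field
    into      : ∀ u → V G (f u)
    hom-E     : ∀ u v → E (F D) u v → EG G (f u) (f v)
    hom-col   : ∀ u → col (F D) (f u) ≡ col (F D) u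
    surj      : ∀ v → V G v → ∃ λ u → f u ≡ v
    edge-surj : ∀ a b → EG G a b →
                ∃ λ u → ∃ λ v → E (F D) u v × f u ≡ a × f v ≡ b
    shrink    : ∀ u → _⪯_ (T D) (f u) u
    idem      : ∀ u → f (f u) ≡ f u

-- g : (G, T[V(G)]) → H past-injective homomorphism.  g is given as a total
-- function on V(F); only its values on V(G) are meaningful.
record IsPastInjHom {C k} (D : Dk C k) (G : ColSub (F D)) (H : Graph C)
         (g : Fin (size (F D)) → Fin (size H)) : Set where
  field
    hom-E   : ∀ a b → EG G a b → E H (g a) (g b)
    hom-col : ∀ a → V G a → col H (g a) ≡ col (F D) a
    past-inj : ∀ a b → V G a → V G b → a ≺⟨ T D ⟩ b → g a ≢ g b

-- equality of two graphs G, G' ⊑col D (same vertices, same edges; colours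
-- agree automatically)
SameGraph : ∀ {C} {F : Graph C} → ColSub F → ColSub F → Set
SameGraph G G' = (∀ v → V G v ⇔ V G' v) × (∀ a b → EG G a b ⇔ EG G' a b)

module Submission where

open import Defs
open import Data.Nat using (ℕ)
open import Data.Fin using (Fin; _≟_)
open import Data.Fin.Properties using (any?)
open import Data.Fin.Induction using (po-wellFounded)
open import Data.Product using (Σ; ∃; _×_; _,_; proj₁; proj₂)
open import Data.Sum using (inj₁; inj₂)
open import Data.Empty using (⊥-elim)
open import Function.Bundles using (mk⇔)
open import Induction.WellFounded using (Acc; acc)
open import Relation.Nullary using (Dec; yes; no; ¬_)
open import Relation.Nullary.Decidable using (_×-dec_; ¬?)
open import Relation.Binary.PropositionalEquality
  using (_≡_; refl; sym; trans; cong; subst; subst₂)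
open import Relation.Binary.Structures using (IsPartialOrder)

-- f u is forced to be the ⪯-least vertex below u with the same h-value as u:
-- the vertices below u form a finite chain, so this least vertex exists, and
-- past-injectivity of g forbids any factorisation from sending u anywhere else.
-- Once f is fixed, G is its image and g = h, so everything is determined.

module _ {n : ℕ} (T : Tree n) where

  private
    module ⪯ = IsPartialOrder (isPO T)

  IsLeastBelow : (Fin n → Set) → Fin n → Fin n → Set
  IsLeastBelow P u m = _⪯_ T m u × P m × (∀ b → _⪯_ T b u → P b → _⪯_ T m b)

  leastBelow-unique : ∀ {P u m m′} → IsLeastBelow P u m → IsLeastBelow P u m′ → m ≡ m′
  leastBelow-unique (m⪯u , Pm , m-least) (m′⪯u , Pm′ , m′-least) =
    ⪯.antisym (m-least _ m′⪯u Pm′) (m′-least _ m⪯u Pm)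

  leastBelow : ∀ {P} → (∀ b → Dec (P b)) → ∀ u → P u → Σ (Fin n) (IsLeastBelow P u)
  leastBelow {P} P? u Pu = descend u (po-wellFounded (isPO T) u) ⪯.refl Pu
    where
    descend : ∀ a → Acc (λ x y → x ≺⟨ T ⟩ y) a → _⪯_ T a u → P a →
              Σ (Fin n) (IsLeastBelow P u)
    descend a (acc rs) a⪯u Pa with any? (λ b → ((_⪯?_ T b a) ×-dec ¬? (b ≟ a)) ×-dec P? b)
    ... | yes (b , b≺a , Pb) = descend b (rs b≺a) (⪯.trans (proj₁ b≺a) a⪯u) Pb
    ... | no ∄b≺a = a , a⪯u , Pa , a-least
      where
      a-least : ∀ b → _⪯_ T b u → P b → _⪯_ T a b
      a-least b b⪯u Pb with down-chain T u a b a⪯u b⪯u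
      ... | inj₁ a⪯b = a⪯b
      ... | inj₂ b⪯a with b ≟ a
      ...   | yes refl = ⪯.refl
      ...   | no b≢a = ⊥-elim (∄b≺a (b , (b⪯a , b≢a) , Pb))

module _ {C : Set} {k : ℕ} (D : Dk C k) where

  private
    Vtx = Fin (size (F D))
    _⪯D_ = _⪯_ (T D)
    module ⪯ = IsPartialOrder (isPO (T D))

  epi-vertices-⊆ : ∀ {G G′ f f′} → IsShrinkingEpi D G f → IsShrinkingEpi D G′ f′ →
                   (∀ u → f u ≡ f′ u) → ∀ v → V G v → V G′ v
  epi-vertices-⊆ {G′ = G′} epi epi′ f≗f′ v Gv =
    let (u , fu≡v) = IsShrinkingEpi.surj epi v Gv
    in subst (V G′) (trans (sym (f≗f′ u)) fu≡v) (IsShrinkingEpi.into epi′ u)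

  epi-edges-⊆ : ∀ {G G′ f f′} → IsShrinkingEpi D G f → IsShrinkingEpi D G′ f′ →
                (∀ u → f u ≡ f′ u) → ∀ a b → EG G a b → EG G′ a b
  epi-edges-⊆ {G′ = G′} epi epi′ f≗f′ a b ab =
    let (u , v , uv , fu≡a , fv≡b) = IsShrinkingEpi.edge-surj epi a b ab
    in subst₂ (EG G′) (trans (sym (f≗f′ u)) fu≡a) (trans (sym (f≗f′ v)) fv≡b)
              (IsShrinkingEpi.hom-E epi′ u v uv)

  epi-target-unique : ∀ {G G′ f f′} → IsShrinkingEpi D G f → IsShrinkingEpi D G′ f′ →
                      (∀ u → f u ≡ f′ u) → SameGraph G G′
  epi-target-unique epi epi′ f≗f′ =
    (λ v → mk⇔ (epi-vertices-⊆ epi epi′ f≗f′ v) (epi-vertices-⊆ epi′ epi f′≗f v)) ,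
    (λ a b → mk⇔ (epi-edges-⊆ epi epi′ f≗f′ a b) (epi-edges-⊆ epi′ epi f′≗f a b))
    where
    f′≗f = λ u → sym (f≗f′ u)

  factorisation-isLeastBelow :
    ∀ {H : Graph C} {h : Vtx → Fin (size H)} {G f g} →
    IsShrinkingEpi D G f → IsPastInjHom D G H g → (∀ u → h u ≡ g (f u)) →
    ∀ u → IsLeastBelow (T D) (λ b → h b ≡ h u) u (f u)
  factorisation-isLeastBelow {h = h} {f = f} {g} epi pinj h≗g∘f u =
    shrink u , h∘f≗h , f-least
    where
    open IsShrinkingEpi epi
    h∘f≗h : h (f u) ≡ h u
    h∘f≗h = trans (h≗g∘f (f u)) (trans (cong g (idem u)) (sym (h≗g∘f u)))
    f-least : ∀ b → b ⪯D u → h b ≡ h u → f u ⪯D b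
    f-least b b⪯u hb≡hu with down-chain (T D) u (f u) b (shrink u) b⪯u
    ... | inj₁ fu⪯b = fu⪯b
    ... | inj₂ b⪯fu with f b ≟ f u
    ...   | yes fb≡fu = subst (_⪯D b) fb≡fu (shrink b)
    ...   | no fb≢fu = ⊥-elim (IsPastInjHom.past-inj pinj (f b) (f u) (into b) (into u)
                          (⪯.trans (shrink b) b⪯fu , fb≢fu)
                          (trans (sym (h≗g∘f b)) (trans hb≡hu (h≗g∘f u))))

module Canonical {C : Set} {k : ℕ} (D : Dk C k) (H : Graph C)
                 (h : Fin (size (F D)) → Fin (size H)) (hom : IsHom (F D) H h) where

  private
    Vtx = Fin (size (F D))
    _⪯D_ = _⪯_ (T D)
    module ⪯ = IsPartialOrder (isPO (T D))

  SameImage : Vtx → Vtx → Set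
  SameImage u b = h b ≡ h u

  least : ∀ u → Σ Vtx (IsLeastBelow (T D) (SameImage u) u)
  least u = leastBelow (T D) (λ b → h b ≟ h u) u refl

  f : Vtx → Vtx
  f u = proj₁ (least u)

  f-least : ∀ u → IsLeastBelow (T D) (SameImage u) u (f u)
  f-least u = proj₂ (least u)

  h∘f≗h : ∀ u → h (f u) ≡ h u
  h∘f≗h u = proj₁ (proj₂ (f-least u))

  f-idem : ∀ u → f (f u) ≡ f u
  f-idem u = leastBelow-unique (T D) (f-least (f u)) (⪯.refl , refl , fu-least)
    where
    fu-least : ∀ b → b ⪯D f u → h b ≡ h (f u) → f u ⪯D b
    fu-least b b⪯fu hb≡hfu =
      proj₂ (proj₂ (f-least u)) b (⪯.trans b⪯fu (proj₁ (f-least u))) (trans hb≡hfu (h∘f≗h u))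

  ImageEdge : Vtx → Vtx → Set
  ImageEdge a b = ∃ λ u → ∃ λ v → E (F D) u v × f u ≡ a × f v ≡ b

  -- An edge uv of F is never collapsed, since h u and h v are adjacent in H.
  imageEdge-irr : ∀ {a} → ¬ ImageEdge a a
  imageEdge-irr (u , v , uv , fu≡a , fv≡a) =
    E-irr H (subst (E H (h u)) hv≡hu (proj₁ hom u v uv))
    where
    hv≡hu : h v ≡ h u
    hv≡hu = trans (sym (h∘f≗h v)) (trans (cong h (trans fv≡a (sym fu≡a))) (h∘f≗h u))

  G : ColSub (F D)
  G = record
    { V = λ v → f v ≡ v
    ; V? = λ v → f v ≟ v
    ; EG = ImageEdge
    ; EG? = λ a b → any? λ u → any? λ v → E? (F D) u v ×-dec ((f u ≟ a) ×-dec (f v ≟ b))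
    ; EG-V = λ { (u , v , _ , refl , refl) → f-idem u , f-idem v }
    ; EG-sym = λ { (u , v , uv , fu≡a , fv≡b) → v , u , E-sym (F D) uv , fv≡b , fu≡a }
    ; EG-irr = imageEdge-irr
    }

  f-epi : IsShrinkingEpi D G f
  f-epi = record
    { into = f-idem
    ; hom-E = λ u v uv → u , v , uv , refl , refl
    ; hom-col = λ u → trans (sym (proj₂ hom (f u)))
                            (trans (cong (col H) (h∘f≗h u)) (proj₂ hom u))
    ; surj = λ v fv≡v → v , fv≡v
    ; edge-surj = λ _ _ ab → ab
    ; shrink = λ u → proj₁ (f-least u)
    ; idem = f-idem
    }

  h-pastInj : IsPastInjHom D G H h
  h-pastInj = record
    { hom-E = λ { _ _ (u , v , uv , refl , refl) →
        subst₂ (E H) (sym (h∘f≗h u)) (sym (h∘f≗h v)) (proj₁ hom u v uv) }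
    ; hom-col = λ a _ → proj₂ hom a
    ; past-inj = λ a b _ fb≡b (a⪯b , a≢b) ha≡hb →
        a≢b (⪯.antisym a⪯b (subst (_⪯D a) fb≡b (proj₂ (proj₂ (f-least b)) a a⪯b ha≡hb)))
    }

lemma7 : ∀ {C : Set} {k : ℕ} (D : Dk C k) (H : Graph C)
           (h : Fin (size (F D)) → Fin (size H)) → IsHom (F D) H h →
           Σ (ColSub (F D)) λ G →
           Σ (Fin (size (F D)) → Fin (size (F D))) λ f →
           Σ (Fin (size (F D)) → Fin (size H)) λ g →
             IsShrinkingEpi D G f × IsPastInjHom D G H g × (∀ u → h u ≡ g (f u))
             × (∀ (G' : ColSub (F D)) (f' : Fin (size (F D)) → Fin (size (F D)))
                  (g' : Fin (size (F D)) → Fin (size H)) →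
                  IsShrinkingEpi D G' f' → IsPastInjHom D G' H g' →
                  (∀ u → h u ≡ g' (f' u)) →
                  SameGraph G G' × (∀ u → f u ≡ f' u) × (∀ v → V G v → g v ≡ g' v))
lemma7 D H h hom =
  G , f , h , f-epi , h-pastInj , (λ u → sym (h∘f≗h u)) , unique
  where
  open Canonical D H h hom
  unique : ∀ G′ f′ g′ → IsShrinkingEpi D G′ f′ → IsPastInjHom D G′ H g′ →
           (∀ u → h u ≡ g′ (f′ u)) →
           SameGraph G G′ × (∀ u → f u ≡ f′ u) × (∀ v → V G v → h v ≡ g′ v)
  unique G′ f′ g′ epi′ pinj′ h≗g′∘f′ =
    epi-target-unique D f-epi epi′ f≗f′ , f≗f′ ,
    λ v fv≡v → trans (h≗g′∘f′ v) (cong g′ (trans (sym (f≗f′ v)) fv≡v))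
    where
    f≗f′ : ∀ u → f u ≡ f′ u
    f≗f′ u = leastBelow-unique (T D) (f-least u)
               (factorisation-isLeastBelow D epi′ pinj′ h≗g′∘f′ u)
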